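{- Let $\Sigma=(\Gamma,\sigma)$ be a signed graph and let $v$ be a vertex of $\Gamma$. Then every circle of $\Sigma$ passing through $v$ is positive (i.e., $v$ belongs only to positive circles) if and only if every block of $\Gamma$ containing $v$ is balanced.
   Context: A signed graph is a pair $\Sigma=(\Gamma,\sigma)$ where $\Gamma$ is a finite simple graph and $\sigma:E(\Gamma)\to\{+,-\}$ is a sign function on the edges. A circle is a cycle (a connected 2-regular subgraph). The sign of a circle is the product of the signs of its edges; a circle is positive or negative accordingly. A subgraph is balanced if all its circles are positive, and unbalanced otherwise. A block of $\Gamma$ is a maximal connected subgraph without a cut vertex. The condition "belongs only to positive circles" is understood vacuously when the vertex lies in no circle. -}

module Defs where

open import Data.Bool using (Bool; true; false)
open import Data.Fin using (Fin)
open import Data.Nat using (ℕ; _≤_)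
open import Data.List using (List; []; _∷_; length; map; foldr)
open import Data.List.Relation.Unary.All using (All)
open import Data.List.Relation.Unary.Unique.Propositional using (Unique)
open import Data.List.Membership.Propositional using (_∈_)
open import Data.Product using (Σ; ∃; _×_; _,_; proj₁; proj₂)
open import Data.Sign using (Sign) renaming (_*_ to _·_)
open import Relation.Binary.PropositionalEquality using (_≡_; _≢_)
open import Relation.Nullary using (¬_)

record Graph (n : ℕ) : Set where
  field
    adj     : Fin n → Fin n → Bool
    adj-sym : ∀ x y → adj x y ≡ adj y x
    adj-irr : ∀ x → adj x x ≡ false

open Graph public

Edge : ∀ {n} → Graph n → Fin n → Fin n → Set
Edge Γ x y = adj Γ x y ≡ true

-- A sign function on the edges of Γ (values off edges are irrelevant;
-- the sign of an edge does not depend on its orientation).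
record Signature {n : ℕ} (Γ : Graph n) : Set where
  field
    sgn     : Fin n → Fin n → Sign
    sgn-sym : ∀ x y → Edge Γ x y → sgn x y ≡ sgn y x

open Signature public

record Subgraph {n : ℕ} (Γ : Graph n) : Set₁ where
  field
    V      : Fin n → Set
    E      : Fin n → Fin n → Set
    E-sym  : ∀ x y → E x y → E y x
    E⊆Γ    : ∀ x y → E x y → Edge Γ x y
    E-ends : ∀ x y → E x y → V x

open Subgraph public

cycPairs : ∀ {n} → List (Fin n) → List (Fin n × Fin n)
cycPairs [] = []
cycPairs (x ∷ xs) = go (x ∷ xs)
  where
  go : List _ → List _
  go [] = []
  go (a ∷ []) = (a , x) ∷ []
  go (a ∷ b ∷ r) = (a , b) ∷ go (b ∷ r)

record CircleIn {n : ℕ} (E : Fin n → Fin n → Set) : Set where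
  field
    verts    : List (Fin n)
    distinct : Unique verts
    long     : 3 ≤ length verts
    edges    : All (λ p → E (proj₁ p) (proj₂ p)) (cycPairs verts)

open CircleIn public

Circle : ∀ {n} → Graph n → Set
Circle Γ = CircleIn (Edge Γ)

CircleOf : ∀ {n} {Γ : Graph n} → Subgraph Γ → Set
CircleOf H = CircleIn (E H)

circleSign : ∀ {n} {Γ : Graph n} {E : Fin n → Fin n → Set} →
             Signature Γ → CircleIn E → Sign
circleSign σ C = foldr _·_ Sign.+ (map (λ p → sgn σ (proj₁ p) (proj₂ p)) (cycPairs (verts C)))

Positive : ∀ {n} {Γ : Graph n} {E : Fin n → Fin n → Set} →
           Signature Γ → CircleIn E → Set
Positive σ C = circleSign σ C ≡ Sign.+

Balanced : ∀ {n} {Γ : Graph n} → Signature Γ → Subgraph Γ → Set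
Balanced σ H = ∀ (C : CircleOf H) → Positive σ C

data Conn {n : ℕ} (W : Fin n → Set) (E : Fin n → Fin n → Set) :
          Fin n → Fin n → Set where
  here : ∀ {a} → W a → Conn W E a a
  step : ∀ {a b c} → W a → E a b → Conn W E b c → Conn W E a c

Connected : ∀ {n} {Γ : Graph n} → Subgraph Γ → Set
Connected H = (∃ λ x → V H x) ×
              (∀ a b → V H a → V H b → Conn (V H) (E H) a b)

Minus : ∀ {n} {Γ : Graph n} → Subgraph Γ → Fin n → Fin n → Set
Minus H x y = V H y × y ≢ x

CutVertex : ∀ {n} {Γ : Graph n} → Subgraph Γ → Fin n → Set
CutVertex H x = V H x × Σ _ λ a → Σ _ λ b →
  Minus H x a × Minus H x b × ¬ Conn (Minus H x) (E H) a b

_⊑_ : ∀ {n} {Γ : Graph n} → Subgraph Γ → Subgraph Γ → Set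
H ⊑ K = (∀ x → V H x → V K x) × (∀ x y → E H x y → E K x y)

ConnNoCut : ∀ {n} {Γ : Graph n} → Subgraph Γ → Set
ConnNoCut H = Connected H × (∀ x → ¬ CutVertex H x)

IsBlock : ∀ {n} {Γ : Graph n} → Subgraph Γ → Set₁
IsBlock {Γ = Γ} H = ConnNoCut H × (∀ (K : Subgraph Γ) → ConnNoCut K → H ⊑ K → K ⊑ H)

-- Let B be a block through v containing a negative circle C, and join v
-- to C by a simple path P meeting C only in its end c.  If v ∉ C, then c is not a cut vertex
-- of B, so some path from v to a neighbour of c on C avoids c.  A stretch of it, from its
-- last visit to P (at u) to its first visit to C (at c′), followed by the part of P from u
-- to c, is a chord of C.  The three circles of this theta graph have signs multiplying to +,
-- so one of the two circles through the chord is negative; it contains u, which is closer to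
-- v along P.  Induction on the length of P yields a negative circle through v.
--
-- A circle is connected without cut vertex, hence lies in a maximal such
-- subgraph, i.e. in a block.  Maximal ones are induced subgraphs, so it suffices to climb
-- through the finitely many vertex sets; constructively this gives the block only under a
-- double negation, which is harmless because the sign of a circle is decidable.

module Submission where

open import Defs
open import Data.Empty using (⊥; ⊥-elim)
open import Data.Fin using (Fin; _≟_)
import Data.Fin as Fin
open import Data.Fin.Subset using (Subset; inside; outside; _⊂_; _⊃_)
  renaming (_∈_ to _∈ₛ_; _⊆_ to _⊆ₛ_)
open import Data.Fin.Subset.Induction using (⊃-wellFounded; Acc; acc)
open import Data.Fin.Subset.Properties using () renaming (_∈?_ to _∈ₛ?_)
open import Data.List using (List; []; _∷_; _++_; [_]; length; map; foldr; reverse; drop)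
open import Data.List.Membership.Propositional using (_∈_; _∉_)
open import Data.List.Membership.Propositional.Properties
  using (∈-++⁺ˡ; ∈-++⁺ʳ; ∈-++⁻; ∈-∃++; ∈-length)
open import Data.List.Properties using (++-assoc; unfold-reverse; reverse-++; length-++)
open import Data.List.Relation.Binary.Disjoint.Propositional using (Disjoint)
open import Data.List.Relation.Binary.Permutation.Propositional
  using (_↭_; ↭-refl; ↭-sym; ↭⇒↭ₛ; module PermutationReasoning)
open import Data.List.Relation.Binary.Permutation.Propositional.Properties
  using (++-comm; ↭-reverse; ↭-length; All-resp-↭; ∈-resp-↭)
import Data.List.Relation.Binary.Permutation.Propositional.Properties as ↭
import Data.List.Relation.Binary.Permutation.Setoid.Properties as ↭ₛ
open import Data.List.Relation.Binary.Subset.Propositional using (_⊆_)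
open import Data.List.Relation.Binary.Subset.Propositional.Properties
  using (⊆-refl; ⊆-trans; ⊆-reflexive; ⊆-reflexive-↭; xs⊆ys++xs; xs⊆xs++ys)
import Data.List.Relation.Binary.Subset.Propositional.Properties as ⊆
open import Data.List.Relation.Unary.All as All using (All; []; _∷_)
import Data.List.Relation.Unary.All.Properties as All
open import Data.List.Relation.Unary.Any using (here; there)
import Data.List.Relation.Unary.Any.Properties as Any
open import Data.List.Relation.Unary.Unique.Propositional using (Unique; []; _∷_)
import Data.List.Relation.Unary.Unique.Propositional.Properties as Unique
open import Data.Nat using (ℕ; zero; suc; _≤_; _<_; s≤s)
open import Data.Nat.Properties using (≤-trans; ≤-pred; <-≤-trans; n<1+n; m≤n+m)
open import Data.Product using (Σ; ∃; _×_; _,_; proj₁; proj₂; map₁; map₂; swap)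
open import Data.Sign using (Sign) renaming (_*_ to _·_)
open import Data.Sign.Properties using (*-assoc; *-isCommutativeMonoid; s≢opposite[s])
  renaming (_≟_ to _≟ˢ_)
open import Data.Sum using (_⊎_; inj₁; inj₂; [_,_]′)
import Data.Vec as Vec
open import Function using (_∘_)
open import Function.Bundles using (_⇔_; mk⇔)
open import Relation.Binary.PropositionalEquality
  using (_≡_; _≢_; refl; sym; trans; cong; cong₂; subst; subst₂; setoid; module ≡-Reasoning)
open import Relation.Nullary using (¬_; Dec; yes; no)
open import Relation.Nullary.Decidable using (decidable-stable; ¬¬-excluded-middle)
open import Relation.Unary using (_≐_) renaming (_⊆_ to _⊆ᵤ_)

module _ {A : Set} where

  Unique-∷ : ∀ {x : A} {xs} → x ∉ xs → Unique xs → Unique (x ∷ xs)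
  Unique-∷ {xs = xs} x∉xs xs! = All.¬Any⇒All¬ xs x∉xs ∷ xs!

  Unique-++⁻ˡ : ∀ (xs : List A) {ys} → Unique (xs ++ ys) → Unique xs
  Unique-++⁻ˡ []       _          = []
  Unique-++⁻ˡ (x ∷ xs) (x∉ ∷ xs!) =
    Unique-∷ (λ x∈xs → All.lookup x∉ (∈-++⁺ˡ x∈xs) refl) (Unique-++⁻ˡ xs xs!)

  Unique-++⁻ʳ : ∀ (xs : List A) {ys} → Unique (xs ++ ys) → Unique ys
  Unique-++⁻ʳ []       ys!       = ys!
  Unique-++⁻ʳ (x ∷ xs) (_ ∷ xs!) = Unique-++⁻ʳ xs xs!

  Unique-++⇒Disjoint : ∀ (xs : List A) {ys} → Unique (xs ++ ys) → Disjoint xs ys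
  Unique-++⇒Disjoint (x ∷ xs) (x∉ ∷ _)   (here refl , z∈ys)   = All.lookup x∉ (∈-++⁺ʳ xs z∈ys) refl
  Unique-++⇒Disjoint (x ∷ xs) (_ ∷ xs!) (there z∈xs , z∈ys) = Unique-++⇒Disjoint xs xs! (z∈xs , z∈ys)

  Unique-resp-↭ : ∀ {xs ys : List A} → xs ↭ ys → Unique xs → Unique ys
  Unique-resp-↭ p = ↭ₛ.Unique-resp-↭ (setoid A) (↭⇒↭ₛ p)

  Unique-prefix : ∀ xs (y : A) {ys} → Unique (xs ++ y ∷ ys) → Unique (xs ++ [ y ])
  Unique-prefix xs y {ys} u = Unique-++⁻ˡ (xs ++ [ y ]) (subst Unique (sym (++-assoc xs [ y ] ys)) u)

  Unique-arcs : ∀ (x : A) as y bs → Unique (x ∷ as ++ y ∷ bs) →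
                Unique (x ∷ as ++ [ y ]) × Unique (y ∷ bs ++ [ x ])
  Unique-arcs x as y bs u =
    Unique-prefix (x ∷ as) y u , Unique-prefix (y ∷ bs) x (Unique-resp-↭ (++-comm (x ∷ as) (y ∷ bs)) u)

  arc₁⊆ : ∀ (x : A) as y bs → x ∷ as ++ [ y ] ⊆ x ∷ as ++ y ∷ bs
  arc₁⊆ x as y bs =
    ⊆-trans (xs⊆xs++ys (x ∷ as ++ [ y ]) bs) (⊆-reflexive (cong (x ∷_) (++-assoc as [ y ] bs)))

  arc₂⊆ : ∀ (x : A) as y bs → y ∷ bs ++ [ x ] ⊆ x ∷ as ++ y ∷ bs
  arc₂⊆ x as y bs = ⊆-trans (arc₁⊆ y bs x as) (⊆-reflexive-↭ (++-comm (y ∷ bs) (x ∷ as)))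

  Disjoint-⊆ : ∀ {xs xs′ ys ys′ : List A} → xs′ ⊆ xs → ys′ ⊆ ys →
               Disjoint xs ys → Disjoint xs′ ys′
  Disjoint-⊆ xs′⊆xs ys′⊆ys xs#ys (z∈xs′ , z∈ys′) = xs#ys (xs′⊆xs z∈xs′ , ys′⊆ys z∈ys′)

  MeetOnlyAt : List A → List A → A → Set
  MeetOnlyAt xs ys w = ∀ {z} → z ∈ xs → z ∈ ys → z ≡ w

  MeetOnlyAt-⊆ : ∀ {xs xs′ ys ys′ w} → xs′ ⊆ xs → ys′ ⊆ ys →
                 MeetOnlyAt xs ys w → MeetOnlyAt xs′ ys′ w
  MeetOnlyAt-⊆ xs′⊆xs ys′⊆ys meet z∈xs′ z∈ys′ = meet (xs′⊆xs z∈xs′) (ys′⊆ys z∈ys′)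

  Disjoint⇒MeetOnlyAt-snoc : ∀ {xs ys} {w : A} → Disjoint xs ys → MeetOnlyAt (xs ++ [ w ]) ys w
  Disjoint⇒MeetOnlyAt-snoc {xs} xs#ys z∈ z∈ys with ∈-++⁻ xs z∈
  ... | inj₁ z∈xs        = ⊥-elim (xs#ys (z∈xs , z∈ys))
  ... | inj₂ (here refl) = refl

  length-++-∷ : ∀ (xs : List A) y {ys u} → u ∈ ys → 2 ≤ length (xs ++ y ∷ ys)
  length-++-∷ xs y {ys} u∈ys rewrite length-++ xs {y ∷ ys} =
    ≤-trans (s≤s (∈-length u∈ys)) (m≤n+m _ (length xs))

  length-snoc< : ∀ (xs : List A) y ys z → length (xs ++ [ y ]) < length (xs ++ y ∷ ys ++ [ z ])
  length-snoc< []       y ys z = s≤s (subst (1 ≤_) (sym (length-++ ys)) (m≤n+m 1 (length ys)))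
  length-snoc< (x ∷ xs) y ys z = s≤s (length-snoc< xs y ys z)

module _ {A : Set} where

  pairs : List A → List (A × A)
  pairs []           = []
  pairs (x ∷ [])     = []
  pairs (x ∷ y ∷ xs) = (x , y) ∷ pairs (y ∷ xs)

  closed : A → List A → List A
  closed x r = x ∷ r ++ [ x ]

  ∈-pairs : ∀ {x y : A} xs → (x , y) ∈ pairs xs → x ∈ xs × y ∈ xs
  ∈-pairs (a ∷ b ∷ xs) (here refl) = here refl , there (here refl)
  ∈-pairs (a ∷ b ∷ xs) (there p)   = map₁ there (map₂ there (∈-pairs (b ∷ xs) p))

  pairs-++ : ∀ xs y ys → pairs (xs ++ y ∷ ys) ≡ pairs (xs ++ [ y ]) ++ pairs (y ∷ ys)
  pairs-++ []            y ys = refl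
  pairs-++ (x ∷ [])      y ys = refl
  pairs-++ (x ∷ x′ ∷ xs) y ys = cong ((x , x′) ∷_) (pairs-++ (x′ ∷ xs) y ys)

  pairs-join : ∀ x as y bs z →
               pairs (x ∷ (as ++ y ∷ bs) ++ [ z ]) ≡ pairs (x ∷ as ++ [ y ]) ++ pairs (y ∷ bs ++ [ z ])
  pairs-join x as y bs z =
    trans (cong (pairs ∘ (x ∷_)) (++-assoc as (y ∷ bs) [ z ])) (pairs-++ (x ∷ as) y (bs ++ [ z ]))

  pairs-reverse : ∀ xs → pairs (reverse xs) ≡ reverse (map swap (pairs xs))
  pairs-reverse []           = refl
  pairs-reverse (x ∷ [])     = refl
  pairs-reverse (x ∷ y ∷ xs) = begin
    pairs (reverse (x ∷ y ∷ xs))                       ≡⟨ cong pairs (unfold-reverse x (y ∷ xs)) ⟩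
    pairs (reverse (y ∷ xs) ++ [ x ])                  ≡⟨ cong (λ l → pairs (l ++ [ x ])) (unfold-reverse y xs) ⟩
    pairs ((reverse xs ++ [ y ]) ++ [ x ])             ≡⟨ cong pairs (++-assoc (reverse xs) [ y ] [ x ]) ⟩
    pairs (reverse xs ++ y ∷ x ∷ [])                   ≡⟨ pairs-++ (reverse xs) y [ x ] ⟩
    pairs (reverse xs ++ [ y ]) ++ [ (y , x) ]         ≡⟨ cong (λ l → pairs l ++ [ (y , x) ]) (unfold-reverse y xs) ⟨
    pairs (reverse (y ∷ xs)) ++ [ (y , x) ]            ≡⟨ cong (_++ [ (y , x) ]) (pairs-reverse (y ∷ xs)) ⟩
    reverse (map swap (pairs (y ∷ xs))) ++ [ (y , x) ] ≡⟨ unfold-reverse (y , x) (map swap (pairs (y ∷ xs))) ⟨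
    reverse (map swap (pairs (x ∷ y ∷ xs)))            ∎
    where open ≡-Reasoning

  reverse-path : ∀ (x : A) ys z → reverse (x ∷ ys ++ [ z ]) ≡ z ∷ reverse ys ++ [ x ]
  reverse-path x ys z = trans (unfold-reverse x (ys ++ [ z ])) (cong (_++ [ x ]) (reverse-++ ys [ z ]))

-- cycPairs recurses through a local helper, which drop 1 exposes for the induction.
cycPairs-closed : ∀ {n} (x : Fin n) r → cycPairs (x ∷ r) ≡ pairs (closed x r)
cycPairs-closed x []      = refl
cycPairs-closed x (a ∷ r) = cong ((x , a) ∷_) (tail-closed a r)
  where
  tail-closed : ∀ a r → drop 1 (cycPairs (x ∷ a ∷ r)) ≡ pairs (a ∷ r ++ [ x ])
  tail-closed a []      = refl
  tail-closed a (b ∷ r) = cong ((a , b) ∷_) (tail-closed b r)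

∈-cycPairs : ∀ {n} xs {x y : Fin n} → (x , y) ∈ cycPairs xs → x ∈ xs × y ∈ xs
∈-cycPairs (z ∷ r) p∈ =
  map₁ closed⊆ (map₂ closed⊆ (∈-pairs (closed z r) (subst (_ ∈_) (cycPairs-closed z r) p∈)))
  where
  closed⊆ : ∀ {w} → w ∈ closed z r → w ∈ z ∷ r
  closed⊆ w∈ with ∈-++⁻ (z ∷ r) w∈
  ... | inj₁ w∈z∷r       = w∈z∷r
  ... | inj₂ (here refl) = here refl

cycPairs-rotate : ∀ {n} {z : Fin n} xs → z ∈ xs →
                  ∃ λ r → xs ↭ z ∷ r × cycPairs xs ↭ cycPairs (z ∷ r)
cycPairs-rotate {z = z} xs z∈xs with ∈-∃++ z∈xs
... | []     , bs , refl = bs , ↭-refl , ↭-refl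
... | x ∷ as , bs , refl = bs ++ x ∷ as , ++-comm (x ∷ as) (z ∷ bs) , rotated
  where
  open PermutationReasoning
  rotated : cycPairs (x ∷ as ++ z ∷ bs) ↭ cycPairs (z ∷ bs ++ x ∷ as)
  rotated = begin
    cycPairs (x ∷ as ++ z ∷ bs)                        ≡⟨ cycPairs-closed x (as ++ z ∷ bs) ⟩
    pairs (closed x (as ++ z ∷ bs))                    ≡⟨ pairs-join x as z bs x ⟩
    pairs (x ∷ as ++ [ z ]) ++ pairs (z ∷ bs ++ [ x ]) ↭⟨ ++-comm (pairs (x ∷ as ++ [ z ])) _ ⟩
    pairs (z ∷ bs ++ [ x ]) ++ pairs (x ∷ as ++ [ z ]) ≡⟨ pairs-join z bs x as z ⟨
    pairs (closed z (bs ++ x ∷ as))                    ≡⟨ cycPairs-closed z (bs ++ x ∷ as) ⟨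
    cycPairs (z ∷ bs ++ x ∷ as)                        ∎

Chain : ∀ {A : Set} → (A → A → Set) → List A → Set
Chain R xs = All (λ p → R (proj₁ p) (proj₂ p)) (pairs xs)

module _ {A : Set} {R : A → A → Set} where

  Chain-join : ∀ x as y bs z → Chain R (x ∷ as ++ [ y ]) → Chain R (y ∷ bs ++ [ z ]) →
               Chain R (x ∷ (as ++ y ∷ bs) ++ [ z ])
  Chain-join x as y bs z ch₁ ch₂ rewrite pairs-join x as y bs z = All.++⁺ ch₁ ch₂

  Chain-split : ∀ x as y bs z → Chain R (x ∷ (as ++ y ∷ bs) ++ [ z ]) →
                Chain R (x ∷ as ++ [ y ]) × Chain R (y ∷ bs ++ [ z ])
  Chain-split x as y bs z ch rewrite pairs-join x as y bs z = All.++⁻ _ ch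

  Chain-init : ∀ xs z → Chain R (xs ++ [ z ]) → Chain R xs
  Chain-init []           z _        = []
  Chain-init (x ∷ [])     z _        = []
  Chain-init (x ∷ y ∷ xs) z (e ∷ ch) = e ∷ Chain-init (y ∷ xs) z ch

  Chain-reverse : (∀ {x y} → R x y → R y x) → ∀ xs → Chain R xs → Chain R (reverse xs)
  Chain-reverse R-sym xs ch rewrite pairs-reverse xs =
    All-resp-↭ (↭-sym (↭-reverse _)) (All.map⁺ (All.map R-sym ch))

·-negative-split : ∀ a b t → a · b ≡ Sign.- → a · t ≡ Sign.- ⊎ b · t ≡ Sign.-
·-negative-split Sign.+ Sign.- Sign.+ _ = inj₂ refl
·-negative-split Sign.+ Sign.- Sign.- _ = inj₁ refl
·-negative-split Sign.- Sign.+ Sign.+ _ = inj₁ refl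
·-negative-split Sign.- Sign.+ Sign.- _ = inj₂ refl

module _ {n} {Γ : Graph n} (σ : Signature Γ) where

  edgeSign : List (Fin n × Fin n) → Sign
  edgeSign ps = foldr _·_ Sign.+ (map (λ p → sgn σ (proj₁ p) (proj₂ p)) ps)

  walkSign : List (Fin n) → Sign
  walkSign xs = edgeSign (pairs xs)

  edgeSign-++ : ∀ ps qs → edgeSign (ps ++ qs) ≡ edgeSign ps · edgeSign qs
  edgeSign-++ []       qs = refl
  edgeSign-++ (p ∷ ps) qs = trans (cong (s ·_) (edgeSign-++ ps qs)) (sym (*-assoc s (edgeSign ps) (edgeSign qs)))
    where
    s : Sign
    s = sgn σ (proj₁ p) (proj₂ p)

  edgeSign-resp-↭ : ∀ {ps qs} → ps ↭ qs → edgeSign ps ≡ edgeSign qs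
  edgeSign-resp-↭ p = ↭ₛ.foldr-commMonoid (setoid Sign) *-isCommutativeMonoid (↭⇒↭ₛ (↭.map⁺ _ p))

  edgeSign-swap : ∀ ps → All (λ p → Edge Γ (proj₁ p) (proj₂ p)) ps →
                  edgeSign (map swap ps) ≡ edgeSign ps
  edgeSign-swap []             []       = refl
  edgeSign-swap ((x , y) ∷ ps) (e ∷ es) =
    cong₂ _·_ (sgn-sym σ y x (trans (adj-sym Γ y x) e)) (edgeSign-swap ps es)

  walkSign-join : ∀ x as y bs z →
                  walkSign (x ∷ (as ++ y ∷ bs) ++ [ z ]) ≡
                  walkSign (x ∷ as ++ [ y ]) · walkSign (y ∷ bs ++ [ z ])
  walkSign-join x as y bs z =
    trans (cong edgeSign (pairs-join x as y bs z))
          (edgeSign-++ (pairs (x ∷ as ++ [ y ])) (pairs (y ∷ bs ++ [ z ])))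

  walkSign-reverse : ∀ xs → Chain (Edge Γ) xs → walkSign (reverse xs) ≡ walkSign xs
  walkSign-reverse xs ch = begin
    walkSign (reverse xs)                    ≡⟨ cong edgeSign (pairs-reverse xs) ⟩
    edgeSign (reverse (map swap (pairs xs))) ≡⟨ edgeSign-resp-↭ (↭-reverse (map swap (pairs xs))) ⟩
    edgeSign (map swap (pairs xs))           ≡⟨ edgeSign-swap (pairs xs) ch ⟩
    walkSign xs                              ∎
    where open ≡-Reasoning

module _ {n} {E : Fin n → Fin n → Set} where

  circleOf : ∀ x r → Unique (x ∷ r) → 2 ≤ length r → Chain E (closed x r) → CircleIn E
  circleOf x r x∷r! long ch = record
    { verts = x ∷ r ; distinct = x∷r! ; long = s≤s long
    ; edges = subst (All _) (sym (cycPairs-closed x r)) ch }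

  circle-vertex : (C : CircleIn E) → ∃ λ x → x ∈ verts C
  circle-vertex record { verts = x ∷ _ }        = x , here refl
  circle-vertex record { verts = [] ; long = () }

  record RootedAt (C : CircleIn E) (z : Fin n) : Set where
    constructor rooted
    field
      rest          : List (Fin n)
      unique        : Unique (z ∷ rest)
      long          : 2 ≤ length rest
      chain         : Chain E (closed z rest)
      same-vertices : verts C ↭ z ∷ rest
      same-edges    : cycPairs (verts C) ↭ pairs (closed z rest)

  rootAt : (C : CircleIn E) → ∀ {z} → z ∈ verts C → RootedAt C z
  rootAt C {z} z∈C with cycPairs-rotate (verts C) z∈C
  ... | r , vs↭ , ps↭ = rooted r
    (Unique-resp-↭ vs↭ (distinct C))
    (≤-pred (subst (3 ≤_) (↭-length vs↭) (long C)))
    (subst (All _) (cycPairs-closed z r) (All-resp-↭ ps↭ (edges C)))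
    vs↭
    (subst (cycPairs (verts C) ↭_) (cycPairs-closed z r) ps↭)

circle-vertex∈ : ∀ {n} {Γ : Graph n} (B : Subgraph Γ) (C : CircleOf B) → ∀ {x} → x ∈ verts C → V B x
circle-vertex∈ B C x∈C with rootAt C x∈C
... | rooted []      _ () _  _ _
... | rooted (y ∷ _) _ _  ch _ _ = E-ends B _ y (All.head ch)

CircleIn-map : ∀ {n} {E E′ : Fin n → Fin n → Set} →
               (∀ {x y} → E x y → E′ x y) → CircleIn E → CircleIn E′
CircleIn-map f C = record { verts = verts C ; distinct = distinct C ; long = long C ; edges = All.map f (edges C) }

Conn-map : ∀ {n} {W W′ : Fin n → Set} {E E′ : Fin n → Fin n → Set} →
           (∀ {x} → W x → W′ x) → (∀ {x y} → E x y → E′ x y) →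
           ∀ {a b} → Conn W E a b → Conn W′ E′ a b
Conn-map f g (here w)     = here (f w)
Conn-map f g (step w e p) = step (f w) (g e) (Conn-map f g p)

module _ {n} {W : Fin n → Set} {E : Fin n → Fin n → Set} where

  open import Data.List.Membership.DecPropositional (_≟_ {n}) using (_∈?_)

  vertices : ∀ {a b} → Conn W E a b → List (Fin n)
  vertices (here {a} _)     = a ∷ []
  vertices (step {a} _ _ p) = a ∷ vertices p

  vertices-chain : ∀ {a b} (p : Conn W E a b) → Chain E (vertices p)
  vertices-chain (here _)                  = []
  vertices-chain (step _ e (here _))       = e ∷ []
  vertices-chain (step _ e p@(step _ _ _)) = e ∷ vertices-chain p

  vertices-All : ∀ {a b} (p : Conn W E a b) → All W (vertices p)
  vertices-All (here w)     = w ∷ []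
  vertices-All (step w _ p) = w ∷ vertices-All p

  source∈ : ∀ {a b} (p : Conn W E a b) → a ∈ vertices p
  source∈ (here _)     = here refl
  source∈ (step _ _ _) = here refl

  target∈ : ∀ {a b} (p : Conn W E a b) → b ∈ vertices p
  target∈ (here _)     = here refl
  target∈ (step _ _ p) = there (target∈ p)

  Conn-source : ∀ {a b} → Conn W E a b → W a
  Conn-source p = All.lookup (vertices-All p) (source∈ p)

  Conn-target : ∀ {a b} → Conn W E a b → W b
  Conn-target p = All.lookup (vertices-All p) (target∈ p)

  vertices-snoc : ∀ {a b} (p : Conn W E a b) → ∃ λ I → vertices p ≡ I ++ [ b ]
  vertices-snoc (here _)         = [] , refl
  vertices-snoc (step {a} _ _ p) with vertices-snoc p
  ... | I , eq = a ∷ I , cong (a ∷_) eq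

  vertices-shape : ∀ {a b} (p : Conn W E a b) → a ≢ b → ∃ λ M → vertices p ≡ a ∷ M ++ [ b ]
  vertices-shape (here _)         a≢a = ⊥-elim (a≢a refl)
  vertices-shape (step {a} _ _ p) _   = map₂ (cong (a ∷_)) (vertices-snoc p)

  _++ᶜ_ : ∀ {a b c} → Conn W E a b → Conn W E b c → Conn W E a c
  here _     ++ᶜ q = q
  step w e p ++ᶜ q = step w e (p ++ᶜ q)

  vertices-++ᶜ : ∀ {a b c} (p : Conn W E a b) (q : Conn W E b c) →
                 vertices (p ++ᶜ q) ⊆ vertices p ++ vertices q
  vertices-++ᶜ (here _)     q z∈         = there z∈
  vertices-++ᶜ (step _ _ p) q (here refl) = here refl
  vertices-++ᶜ (step _ _ p) q (there z∈)  = there (vertices-++ᶜ p q z∈)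

  module _ (E-sym : ∀ {x y} → E x y → E y x) where

    Conn-reverse : ∀ {a b} → Conn W E a b → Conn W E b a
    Conn-reverse (here w)     = here w
    Conn-reverse (step w e p) = Conn-reverse p ++ᶜ step (Conn-source p) (E-sym e) (here w)

    vertices-reverse : ∀ {a b} (p : Conn W E a b) → vertices (Conn-reverse p) ⊆ vertices p
    vertices-reverse (here _)     z∈ = z∈
    vertices-reverse (step _ _ p) z∈
      with ∈-++⁻ (vertices (Conn-reverse p)) (vertices-++ᶜ (Conn-reverse p) _ z∈)
    ... | inj₁ z∈p                 = there (vertices-reverse p z∈p)
    ... | inj₂ (here refl)         = there (source∈ p)
    ... | inj₂ (there (here refl)) = here refl

  splitAt : ∀ {a b z} (p : Conn W E a b) → z ∈ vertices p →
            Σ (Conn W E a z) λ q → Σ (Conn W E z b) λ r → ∃ λ pre →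
              vertices p ≡ pre ++ vertices r × vertices q ≡ pre ++ [ z ]
  splitAt (here w)         (here refl) = here w , here w , [] , refl , refl
  splitAt (step w e p)     (here refl) = here w , step w e p , [] , refl , refl
  splitAt (step {a} w e p) (there z∈p) with splitAt p z∈p
  ... | q , r , pre , eq₁ , eq₂ = step w e q , r , a ∷ pre , cong (a ∷_) eq₁ , cong (a ∷_) eq₂

  loopErase : ∀ {a b} (p : Conn W E a b) →
              Σ (Conn W E a b) λ q → Unique (vertices q) × vertices q ⊆ vertices p
  loopErase (here w) = here w , [] ∷ [] , λ z∈ → z∈
  loopErase (step {a} w e p) with loopErase p
  ... | q , q! , q⊆p with a ∈? vertices q
  ...   | no a∉q =
    step w e q , Unique-∷ a∉q q! , λ { (here refl) → here refl ; (there z∈q) → there (q⊆p z∈q) }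
  ...   | yes a∈q with splitAt q a∈q
  ...     | _ , r , pre , eq , _ =
    r , Unique-++⁻ʳ pre (subst Unique eq q!) ,
    λ z∈r → there (q⊆p (subst (_ ∈_) (sym eq) (∈-++⁺ʳ pre z∈r)))

  firstHit : ∀ {a b} (L : List (Fin n)) (p : Conn W E a b) → b ∈ L →
             ∃ λ c → Σ (Conn W E a c) λ q →
               c ∈ L × MeetOnlyAt (vertices q) L c × vertices q ⊆ vertices p
  firstHit L (here w) b∈L = _ , here w , b∈L , (λ { (here refl) _ → refl }) , λ z∈ → z∈
  firstHit {a} L (step w e p) b∈L with a ∈? L
  ... | yes a∈L = a , here w , a∈L , (λ { (here refl) _ → refl }) , λ { (here refl) → here refl }
  ... | no a∉L with firstHit L p b∈L
  ...   | c , q , c∈L , only , q⊆p = c , step w e q , c∈L ,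
          (λ { (here refl) z∈L → ⊥-elim (a∉L z∈L) ; (there z∈q) z∈L → only z∈q z∈L }) ,
          λ { (here refl) → here refl ; (there z∈q) → there (q⊆p z∈q) }

  Chain-walk : ∀ {x xs b} → Chain E (x ∷ xs) → All W (x ∷ xs) → b ∈ x ∷ xs → Conn W E x b
  Chain-walk {xs = []}    _        (w ∷ [])  (here refl) = here w
  Chain-walk {xs = _ ∷ _} _        (w ∷ _)   (here refl) = here w
  Chain-walk {xs = _ ∷ _} (e ∷ ch) (w ∷ ws)  (there b∈)  = step w e (Chain-walk ch ws b∈)

  Chain-connects : (∀ {x y} → E x y → E y x) → ∀ {x xs a b} → Chain E (x ∷ xs) → All W (x ∷ xs) →
                   a ∈ x ∷ xs → b ∈ x ∷ xs → Conn W E a b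
  Chain-connects E-sym ch ws a∈ b∈ = Conn-reverse E-sym (Chain-walk ch ws a∈) ++ᶜ Chain-walk ch ws b∈

-- Theta graphs

module _ {n} {Γ : Graph n} (σ : Signature Γ) (B : Subgraph Γ) where

  Negative : CircleOf B → Set
  Negative C = circleSign σ C ≡ Sign.-

  glue : ∀ x P y Q {u} → Unique (x ∷ P ++ [ y ]) → Unique Q → Disjoint (x ∷ P ++ [ y ]) Q → u ∈ Q →
         Chain (E B) (x ∷ P ++ [ y ]) → Chain (E B) (y ∷ Q ++ [ x ]) →
         Σ (CircleOf B) λ D → verts D ≡ (x ∷ P ++ [ y ]) ++ Q ×
           circleSign σ D ≡ walkSign σ (x ∷ P ++ [ y ]) · walkSign σ (y ∷ Q ++ [ x ])
  glue x P y Q P! Q! P#Q u∈Q chP chQ =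
    circleOf x (P ++ y ∷ Q) (subst Unique (sym vertices≡) (Unique.++⁺ P! Q! P#Q))
             (length-++-∷ P y u∈Q) (Chain-join x P y Q x chP chQ) ,
    vertices≡ , trans (cong (edgeSign σ) (cycPairs-closed x (P ++ y ∷ Q))) (walkSign-join σ x P y Q x)
    where
    vertices≡ : x ∷ P ++ y ∷ Q ≡ (x ∷ P ++ [ y ]) ++ Q
    vertices≡ = cong (x ∷_) (sym (++-assoc P [ y ] Q))

  -- The signs of the three circles of the theta graph L ∪ I multiply to +.
  NegativeCircleVia : List (Fin n) → List (Fin n) → Set
  NegativeCircleVia L I = Σ (CircleOf B) λ D → Negative D × I ⊆ verts D × verts D ⊆ L ++ I

  theta : ∀ c as c′ bs {I u} → let L = c ∷ as ++ c′ ∷ bs in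
          Unique L → Chain (E B) (closed c (as ++ c′ ∷ bs)) →
          walkSign σ (closed c (as ++ c′ ∷ bs)) ≡ Sign.- →
          Chain (E B) (c′ ∷ I ++ [ c ]) → Unique I → Disjoint L I → u ∈ I → NegativeCircleVia L I
  theta c as c′ bs {I} {u} L! chL negL chI I! L#I u∈I =
    [ viaArc₁ , viaArc₂ ]′ (·-negative-split (walkSign σ α) (walkSign σ β) (walkSign σ τ) αβ≡-)
    where
    L α β τ : List (Fin n)
    L = c ∷ as ++ c′ ∷ bs
    α = c ∷ as ++ [ c′ ]
    β = c′ ∷ bs ++ [ c ]
    τ = c′ ∷ I ++ [ c ]
    αβ≡- : walkSign σ α · walkSign σ β ≡ Sign.-
    αβ≡- = trans (sym (walkSign-join σ c as c′ bs c)) negL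
    chα : Chain (E B) α
    chα = proj₁ (Chain-split c as c′ bs c chL)
    chβ : Chain (E B) β
    chβ = proj₂ (Chain-split c as c′ bs c chL)
    τʳ≡ : reverse τ ≡ c ∷ reverse I ++ [ c′ ]
    τʳ≡ = reverse-path c′ I c
    chτʳ : Chain (E B) (c ∷ reverse I ++ [ c′ ])
    chτʳ = subst (Chain (E B)) τʳ≡ (Chain-reverse (E-sym B _ _) τ chI)
    sign-τʳ : walkSign σ (c ∷ reverse I ++ [ c′ ]) ≡ walkSign σ τ
    sign-τʳ = trans (cong (walkSign σ) (sym τʳ≡)) (walkSign-reverse σ τ (All.map (E⊆Γ B _ _) chI))
    I⊆Iʳ : I ⊆ reverse I
    I⊆Iʳ = ⊆-reflexive-↭ (↭-sym (↭-reverse I))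
    viaArc₁ : walkSign σ α · walkSign σ τ ≡ Sign.- → NegativeCircleVia L I
    viaArc₁ neg with glue c as c′ I (proj₁ (Unique-arcs c as c′ bs L!)) I!
                          (Disjoint-⊆ (arc₁⊆ c as c′ bs) ⊆-refl L#I) u∈I chα chI
    ... | D , D≡ , sD = D , trans sD neg , ⊆-trans (xs⊆ys++xs I α) (⊆-reflexive (sym D≡))
                      , ⊆-trans (⊆-reflexive D≡) (⊆.++⁺ (arc₁⊆ c as c′ bs) ⊆-refl)
    viaArc₂ : walkSign σ β · walkSign σ τ ≡ Sign.- → NegativeCircleVia L I
    viaArc₂ neg with glue c′ bs c (reverse I) (proj₂ (Unique-arcs c as c′ bs L!))
                          (Unique-resp-↭ (↭-sym (↭-reverse I)) I!)
                          (Disjoint-⊆ (arc₂⊆ c as c′ bs) (⊆-reflexive-↭ (↭-reverse I)) L#I)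
                          (Any.reverse⁺ u∈I) chβ chτʳ
    ... | D , D≡ , sD = D , trans sD (trans (cong (walkSign σ β ·_) sign-τʳ) neg)
                      , ⊆-trans I⊆Iʳ (⊆-trans (xs⊆ys++xs (reverse I) β) (⊆-reflexive (sym D≡)))
                      , ⊆-trans (⊆-reflexive D≡)
                                (⊆.++⁺ (arc₂⊆ c as c′ bs) (⊆-reflexive-↭ (↭-reverse I)))

  theta-rooted : (C : CircleOf B) → Negative C →
                 ∀ {c c′ I u} (R : RootedAt C c) → c′ ∈ RootedAt.rest R →
                 Chain (E B) (c′ ∷ I ++ [ c ]) → Unique I → Disjoint (verts C) I → u ∈ I →
                 NegativeCircleVia (verts C) I
  theta-rooted C neg {c} {c′} {I} (rooted rest rest! _ chain C↭ edges↭) c′∈rest chI I! C#I u∈I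
    with ∈-∃++ c′∈rest
  ... | as , bs , refl =
    widen (theta c as c′ bs rest! chain (trans (sym (edgeSign-resp-↭ σ edges↭)) neg) chI I!
                 (Disjoint-⊆ (⊆-reflexive-↭ (↭-sym C↭)) ⊆-refl C#I) u∈I)
    where
    widen : NegativeCircleVia (c ∷ as ++ c′ ∷ bs) I → NegativeCircleVia (verts C) I
    widen (D , negD , I⊆D , D⊆L++I) =
      D , negD , I⊆D , ⊆-trans D⊆L++I (⊆.++⁺ (⊆-reflexive-↭ (↭-sym C↭)) ⊆-refl)

-- Positive circles through v force balanced blocks

-- The chord I = M u MP made of a detour Q = c′ M u and the end u MP c of the path P.
splice : ∀ {A : Set} {pre MP M L : List A} {u c c′ : A} →
         let P = pre ++ u ∷ MP ++ [ c ] ; Q = c′ ∷ M ++ [ u ] ; I = M ++ u ∷ MP in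
         Unique P → MeetOnlyAt P L c → Unique Q → MeetOnlyAt Q P u → MeetOnlyAt Q L c′ →
         Unique I × Disjoint L I × Disjoint pre (L ++ I)
splice {pre = pre} {MP} {M} {L} {u} {c} {c′} P! P∩L Q! Q∩P Q∩L = I! , L#I , pre#L++I
  where
  tail! : Unique (u ∷ MP ++ [ c ])
  tail! = Unique-++⁻ʳ pre P!
  c∉uMP : c ∉ u ∷ MP
  c∉uMP c∈ = Unique-++⇒Disjoint (u ∷ MP) tail! (c∈ , here refl)
  M++u! : Unique (M ++ [ u ])
  M++u! = Unique-++⁻ʳ [ c′ ] Q!
  u∉M : u ∉ M
  u∉M u∈ = Unique-++⇒Disjoint M M++u! (u∈ , here refl)
  c′∉M : c′ ∉ M
  c′∉M c′∈ = Unique.Unique[x∷xs]⇒x∉xs Q! (∈-++⁺ˡ c′∈)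
  M⊆Q : M ⊆ c′ ∷ M ++ [ u ]
  M⊆Q = there ∘ ∈-++⁺ˡ
  uMP⊆P : u ∷ MP ⊆ pre ++ u ∷ MP ++ [ c ]
  uMP⊆P = ∈-++⁺ʳ pre ∘ xs⊆xs++ys (u ∷ MP) [ c ]
  I! : Unique (M ++ u ∷ MP)
  I! = Unique.++⁺ (Unique-++⁻ˡ M M++u!) (Unique-++⁻ˡ (u ∷ MP) tail!)
         λ (z∈M , z∈uMP) → u∉M (subst (_∈ M) (Q∩P (M⊆Q z∈M) (uMP⊆P z∈uMP)) z∈M)
  L#I : Disjoint L (M ++ u ∷ MP)
  L#I (z∈L , z∈I) with ∈-++⁻ M z∈I
  ... | inj₁ z∈M   = c′∉M (subst (_∈ M) (Q∩L (M⊆Q z∈M) z∈L) z∈M)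
  ... | inj₂ z∈uMP = c∉uMP (subst (_∈ u ∷ MP) (P∩L (uMP⊆P z∈uMP) z∈L) z∈uMP)
  pre#L++I : Disjoint pre (L ++ M ++ u ∷ MP)
  pre#L++I (z∈pre , z∈L++I) = Unique-++⇒Disjoint pre P! (z∈pre , z∈tail)
    where
    z∈P : _ ∈ pre ++ u ∷ MP ++ [ c ]
    z∈P = ∈-++⁺ˡ z∈pre
    z∈tail : _ ∈ u ∷ MP ++ [ c ]
    z∈tail with ∈-++⁻ L z∈L++I
    ... | inj₁ z∈L = subst (_∈ u ∷ MP ++ [ c ]) (sym (P∩L z∈P z∈L)) (there (∈-++⁺ʳ MP (here refl)))
    ... | inj₂ z∈I with ∈-++⁻ M z∈I
    ...   | inj₁ z∈M   = subst (_∈ u ∷ MP ++ [ c ]) (sym (Q∩P (M⊆Q z∈M) z∈P)) (here refl)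
    ...   | inj₂ z∈uMP = xs⊆xs++ys (u ∷ MP) [ c ] z∈uMP

module _ {n} {Γ : Graph n} (B : Subgraph Γ) (v : Fin n) where

  record Detour (c : Fin n) (rest P : List (Fin n)) : Set where
    field
      {start finish} : Fin n
      interior       : List (Fin n)
      start∈rest     : start ∈ rest
      finish∈P       : finish ∈ P
      finish≢c       : finish ≢ c
      chain          : Chain (E B) (start ∷ interior ++ [ finish ])
      unique         : Unique (start ∷ interior ++ [ finish ])
      meets-P        : MeetOnlyAt (start ∷ interior ++ [ finish ]) P finish
      meets-circle   : MeetOnlyAt (start ∷ interior ++ [ finish ]) (c ∷ rest) start

  -- Of a walk from v ∈ P to the circle c ∷ rest avoiding c, keep the stretch between its
  -- first visit to the circle and the last visit to P before it.
  detour : ∀ {c b rest P} → Conn (Minus B c) (E B) v b → b ∈ rest → v ∈ P →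
           MeetOnlyAt P (c ∷ rest) c → Detour c rest P
  detour {c} {rest = rest} {P} Q₀ b∈rest v∈P P∩C with firstHit rest Q₀ b∈rest
  ... | c′ , Q₁ , c′∈rest , Q₁∩rest , _ with firstHit P (Conn-reverse (E-sym B _ _) Q₁) v∈P
  ... | u , Q₂ , u∈P , Q₂∩P , Q₂⊆Q₁ʳ with loopErase Q₂
  ... | Q , Q! , Q⊆Q₂
    with vertices-shape Q (λ { refl → proj₂ (Conn-target Q₂) (P∩C u∈P (there c′∈rest)) })
  ... | M , Q≡ = record
    { interior = M ; start∈rest = c′∈rest ; finish∈P = u∈P ; finish≢c = proj₂ (Conn-target Q₂)
    ; chain = subst (Chain (E B)) Q≡ (vertices-chain Q) ; unique = subst Unique Q≡ Q!
    ; meets-P = MeetOnlyAt-⊆ (Q⊆Q₂ ∘ ⊆-reflexive (sym Q≡)) ⊆-refl Q₂∩P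
    ; meets-circle = meets-circle }
    where
    Q⊆Q₁ : c′ ∷ M ++ [ u ] ⊆ vertices Q₁
    Q⊆Q₁ = vertices-reverse (E-sym B _ _) Q₁ ∘ Q₂⊆Q₁ʳ ∘ Q⊆Q₂ ∘ ⊆-reflexive (sym Q≡)
    meets-circle : MeetOnlyAt (c′ ∷ M ++ [ u ]) (c ∷ rest) c′
    meets-circle z∈Q (here refl)    = ⊥-elim (proj₂ (All.lookup (vertices-All Q₁) (Q⊆Q₁ z∈Q)) refl)
    meets-circle z∈Q (there z∈rest) = Q₁∩rest (Q⊆Q₁ z∈Q) z∈rest

module _ {n} {Γ : Graph n} (σ : Signature Γ) (B : Subgraph Γ) (v : Fin n) where

  open import Data.List.Membership.DecPropositional (_≟_ {n}) using (_∈?_)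

  record Approach (C : CircleOf B) : Set where
    constructor approach
    field
      {end}    : Fin n
      end∈C    : end ∈ verts C
      path     : Conn (V B) (E B) v end
      simple   : Unique (vertices path)
      only-end : MeetOnlyAt (vertices path) (verts C) end

  open Approach

  distance : ∀ {C} → Approach C → ℕ
  distance A = length (vertices (path A))

  Closer : ∀ {C} → Approach C → Set
  Closer A = Σ (CircleOf B) λ C′ → Negative σ B C′ ×
             Σ (Approach C′) λ A′ → distance A′ < distance A

  descend : (C : CircleOf B) → Negative σ B C → (A : Approach C) (R : RootedAt C (end A)) → ∀ {b r} →
            RootedAt.rest R ≡ b ∷ r → Conn (Minus B (end A)) (E B) v b → Closer A
  descend C neg (approach {c} c∈C P P! P∩C) R {b} rest≡ Q₀
    with detour B v Q₀ (subst (b ∈_) (sym rest≡) (here refl)) (source∈ P)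
                (MeetOnlyAt-⊆ ⊆-refl (⊆-reflexive-↭ (↭-sym (RootedAt.same-vertices R))) P∩C)
  ... | record { start = c′ ; finish = u ; interior = M ; start∈rest = c′∈rest ; finish∈P = u∈P
               ; finish≢c = u≢c ; chain = chQ ; unique = Q! ; meets-P = Q∩P ; meets-circle = Q∩C }
    with splitAt P u∈P
  ... | q , r , pre , P≡ , q≡ with vertices-shape r u≢c
  ... | MP , r≡ with trans P≡ (cong (pre ++_) r≡)
  ... | P≡′ with splice (subst Unique P≡′ P!) (MeetOnlyAt-⊆ (⊆-reflexive (sym P≡′)) ⊆-refl P∩C)
                        Q! (MeetOnlyAt-⊆ ⊆-refl (⊆-reflexive (sym P≡′)) Q∩P)
                        (MeetOnlyAt-⊆ ⊆-refl (⊆-reflexive-↭ (RootedAt.same-vertices R)) Q∩C)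
  ... | I! , C#I , pre#C++I
    with theta-rooted σ B C neg R c′∈rest
           (Chain-join c′ M u MP c chQ (subst (Chain (E B)) r≡ (vertices-chain r)))
           I! C#I (∈-++⁺ʳ M (here refl))
  ... | D , negD , I⊆D , D⊆C++I =
    D , negD , approach (I⊆D (∈-++⁺ʳ M (here refl))) q q! q∩D ,
    subst₂ (λ xs ys → length xs < length ys) (sym q≡) (sym P≡′) (length-snoc< pre u MP c)
    where
    q! : Unique (vertices q)
    q! = subst Unique (sym q≡) (Unique-prefix pre u (subst Unique P≡′ P!))
    q∩D : MeetOnlyAt (vertices q) (verts D) u
    q∩D = MeetOnlyAt-⊆ (⊆-reflexive q≡) D⊆C++I (Disjoint⇒MeetOnlyAt-snoc pre#C++I)

  module _ (noCut : ∀ x → ¬ CutVertex B x)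
           (positive-through-v : (C : CircleOf B) → v ∈ verts C → ¬ Negative σ B C) where

    no-negative-approach : ∀ k (C : CircleOf B) → Negative σ B C → (A : Approach C) → distance A < k → ⊥
    no-negative-approach zero    C neg A ()
    no-negative-approach (suc k) C neg A@(approach {c} c∈C P _ _) A<k with v ∈? verts C | rootAt C c∈C
    ... | yes v∈C | _ = positive-through-v C v∈C neg
    ... | no _    | rooted [] _ () _ _ _
    ... | no v∉C  | R@(rooted (b ∷ r) c∷b∷r! _ ch _ _) =
      noCut c (Conn-target P , v , b , (Conn-source P , v≢c) , (b∈B , b≢c) ,
               λ Q₀ → closer (descend C neg A R refl Q₀))
      where
      v≢c : v ≢ c
      v≢c refl = v∉C c∈C
      b∈B : V B b
      b∈B = E-ends B b c (E-sym B c b (All.head ch))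
      b≢c : b ≢ c
      b≢c refl = Unique.Unique[x∷xs]⇒x∉xs c∷b∷r! (here refl)
      closer : Closer A → ⊥
      closer (C′ , neg′ , A′ , A′<A) =
        no-negative-approach k C′ neg′ A′ (<-≤-trans A′<A (≤-pred A<k))

    cutFree-balanced : Connected B → V B v → Balanced σ B
    cutFree-balanced (_ , connected) v∈B D with circleSign σ D in D-
    ... | Sign.+ = refl
    ... | Sign.- with circle-vertex D
    ...   | x , x∈D with firstHit (verts D) (connected v x v∈B (circle-vertex∈ B D x∈D)) x∈D
    ...     | c , P₀ , c∈D , P₀∩D , _ with loopErase P₀
    ...       | P , P! , P⊆P₀ =
      ⊥-elim (no-negative-approach _ D D- (approach c∈D P P! (MeetOnlyAt-⊆ P⊆P₀ ⊆-refl P₀∩D))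
                                   (n<1+n _))

-- Every circle lies in a block

module _ {n} {Γ : Graph n} where

  induced : (Fin n → Set) → Subgraph Γ
  induced U = record
    { V      = U
    ; E      = λ x y → Edge Γ x y × U x × U y
    ; E-sym  = λ { x y (e , ux , uy) → trans (adj-sym Γ y x) e , uy , ux }
    ; E⊆Γ    = λ _ _ → proj₁
    ; E-ends = λ _ _ → proj₁ ∘ proj₂ }

  Chain-induced : ∀ {U} xs → Chain (Edge Γ) xs → All U xs → Chain (E (induced U)) xs
  Chain-induced []           _        _              = []
  Chain-induced (x ∷ [])     _        _              = []
  Chain-induced (x ∷ y ∷ xs) (e ∷ ch) (ux ∷ uy ∷ us) =
    (e , ux , uy) ∷ Chain-induced (y ∷ xs) ch (uy ∷ us)

  ⊑-induced : ∀ {U} (K : Subgraph Γ) → (∀ x → V K x → U x) → K ⊑ induced U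
  ⊑-induced K K⊆U =
    K⊆U , λ x y e → E⊆Γ K x y e , K⊆U x (E-ends K x y e) , K⊆U y (E-ends K y x (E-sym K x y e))

  ConnNoCut-spanning : ∀ {H K : Subgraph Γ} → (∀ x → V K x → V H x) → H ⊑ K →
                       ConnNoCut H → ConnNoCut K
  ConnNoCut-spanning {H} {K} K⊆H (H⊆K , EH⊆EK) (((x , x∈H) , connected) , noCut) =
    ((x , H⊆K x x∈H) ,
     λ a b a∈K b∈K → Conn-map (H⊆K _) (EH⊆EK _ _) (connected a b (K⊆H a a∈K) (K⊆H b b∈K))) ,
    λ z (z∈K , a , b , (a∈K , a≢z) , (b∈K , b≢z) , disconnected) →
      noCut z (K⊆H z z∈K , a , b , (K⊆H a a∈K , a≢z) , (K⊆H b b∈K , b≢z) ,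
               disconnected ∘ Conn-map (map₁ (H⊆K _)) (EH⊆EK _ _))

  ConnNoCut-induced : ∀ {U} (K : Subgraph Γ) → ConnNoCut K → V K ≐ U → ConnNoCut (induced U)
  ConnNoCut-induced {U} K cc (K⊆U , U⊆K) =
    ConnNoCut-spanning {H = K} {K = induced U} (λ x → U⊆K {x}) (⊑-induced K (λ x → K⊆U {x})) cc

  circle-ConnNoCut : (C : Circle Γ) → ConnNoCut (induced (_∈ verts C))
  circle-ConnNoCut C = (circle-vertex C , connected) , noCut
    where
    H : Subgraph Γ
    H = induced (_∈ verts C)
    around : ∀ {z} (R : RootedAt C z) → Chain (E H) (z ∷ RootedAt.rest R)
    around {z} (rooted rest _ _ ch C↭ _) =
      Chain-induced (z ∷ rest) (Chain-init (z ∷ rest) z ch) (All.tabulate (∈-resp-↭ (↭-sym C↭)))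
    connected : ∀ a b → a ∈ verts C → b ∈ verts C → Conn (V H) (E H) a b
    connected a b a∈C b∈C with rootAt C a∈C
    ... | R@(rooted rest _ _ _ C↭ _) =
      Chain-connects (E-sym H _ _) (around R) (All.tabulate (∈-resp-↭ (↭-sym C↭)))
                     (here refl) (∈-resp-↭ C↭ b∈C)
    noCut : ∀ z → ¬ CutVertex H z
    noCut z (z∈C , a , b , (a∈C , a≢z) , (b∈C , b≢z) , disconnected) with rootAt C z∈C
    ... | rooted [] _ () _ _ _
    ... | R@(rooted (y ∷ r) z∷y∷r! _ _ C↭ _) =
      disconnected (Chain-connects (E-sym H _ _) (All.tail (around R)) avoids-z
                                   (off-z a∈C a≢z) (off-z b∈C b≢z))
      where
      avoids-z : All (Minus H z) (y ∷ r)
      avoids-z = All.tabulate λ w∈ →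
        ∈-resp-↭ (↭-sym C↭) (there w∈) , λ { refl → Unique.Unique[x∷xs]⇒x∉xs z∷y∷r! w∈ }
      off-z : ∀ {w} → w ∈ verts C → w ≢ z → w ∈ y ∷ r
      off-z w∈C w≢z with ∈-resp-↭ C↭ w∈C
      ... | here w≡z = ⊥-elim (w≢z w≡z)
      ... | there w∈ = w∈

  circle-in-induced : (C : Circle Γ) → CircleOf (induced (_∈ verts C))
  circle-in-induced C = record
    { verts = verts C ; distinct = distinct C ; long = long C
    ; edges = All.tabulate λ {p} p∈ → All.lookup (edges C) p∈ , ∈-cycPairs (verts C) p∈ }

¬¬-subset : ∀ {n} (U : Fin n → Set) → ¬ ¬ (Σ (Subset n) λ S → U ≐ (_∈ₛ S))
¬¬-subset {zero}  U k = k (Vec.[] , (λ { {()} }) , λ { {()} })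
¬¬-subset {suc n} U k =
  ¬¬-excluded-middle λ U0? → ¬¬-subset (U ∘ Fin.suc) λ (S , to , from) → k (extend U0? S to from)
  where
  extend : Dec (U Fin.zero) → ∀ S → (U ∘ Fin.suc) ⊆ᵤ (_∈ₛ S) → (_∈ₛ S) ⊆ᵤ (U ∘ Fin.suc) →
           Σ (Subset (suc n)) λ S′ → U ≐ (_∈ₛ S′)
  extend (yes u0) S to from =
    inside Vec.∷ S , (λ { {Fin.zero} _ → Vec.here ; {Fin.suc x} u → Vec.there (to u) })
                   , (λ { {Fin.zero} _ → u0 ; {Fin.suc x} (Vec.there x∈S) → from x∈S })
  extend (no ¬u0) S to from =
    outside Vec.∷ S , (λ { {Fin.zero} u → ⊥-elim (¬u0 u) ; {Fin.suc x} u → Vec.there (to u) })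
                    , (λ { {Fin.suc x} (Vec.there x∈S) → from x∈S })

module _ {n} (P : Subset n → Set) where

  Maximal : Subset n → Set
  Maximal M = ∀ {S} → P S → M ⊆ₛ S → S ⊆ₛ M

  ¬¬-maximal-above : ∀ {S} → P S → ¬ ¬ (Σ (Subset n) λ M → P M × S ⊆ₛ M × Maximal M)
  ¬¬-maximal-above = climb (⊃-wellFounded _)
    where
    climb : ∀ {S} → Acc _⊃_ S → P S → ¬ ¬ (Σ (Subset n) λ M → P M × S ⊆ₛ M × Maximal M)
    climb {S} (acc larger) PS k = ¬¬-excluded-middle {A = Σ (Subset n) λ S′ → P S′ × S ⊂ S′} λ where
      (yes (S′ , PS′ , S⊂S′)) →
        climb (larger S⊂S′) PS′ λ (M , PM , S′⊆M , max) → k (M , PM , S′⊆M ∘ proj₁ S⊂S′ , max)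
      (no no-larger) →
        k (S , PS , (λ x∈S → x∈S) , λ {S′} PS′ S⊆S′ {x} x∈S′ →
           decidable-stable (x ∈ₛ? S) λ x∉S → no-larger (S′ , PS′ , S⊆S′ , x , x∈S′ , x∉S))

module _ {n} {Γ : Graph n} where

  ¬¬-block-above : (H : Subgraph Γ) → ConnNoCut H → ¬ ¬ (Σ (Subgraph Γ) λ B → IsBlock B × H ⊑ B)
  ¬¬-block-above H ccH k =
    ¬¬-subset (V H) λ (S , H⊆S , S⊆H) →
    ¬¬-maximal-above P (ConnNoCut-induced H ccH (H⊆S , S⊆H)) λ (M , PM , S⊆M , M-max) →
    k (induced (_∈ₛ M) , (PM , λ K ccK M⊑K → ⊑-induced K (λ _ → in-M M-max K ccK M⊑K)) ,
       ⊑-induced H (λ _ → S⊆M ∘ H⊆S))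
    where
    P : Subset n → Set
    P S = ConnNoCut (induced {Γ = Γ} (_∈ₛ S))
    in-M : ∀ {M} → Maximal P M → (K : Subgraph Γ) → ConnNoCut K → induced (_∈ₛ M) ⊑ K →
           ∀ {x} → V K x → x ∈ₛ M
    in-M {M} M-max K ccK M⊑K {x} x∈K = decidable-stable (x ∈ₛ? M) λ x∉M →
      ¬¬-subset (V K) λ (SK , K⊆SK , SK⊆K) →
      x∉M (M-max (ConnNoCut-induced K ccK (K⊆SK , SK⊆K)) (K⊆SK ∘ proj₁ M⊑K _) (K⊆SK x∈K))

module _ {n} {Γ : Graph n} (σ : Signature Γ) (v : Fin n) where

  positive-through⇒blocks-balanced : ((C : Circle Γ) → v ∈ verts C → Positive σ C) →
                                     (B : Subgraph Γ) → IsBlock B → V B v → Balanced σ B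
  positive-through⇒blocks-balanced positive B ((connected , noCut) , _) v∈B =
    cutFree-balanced σ B v noCut
      (λ C v∈C neg → s≢opposite[s] Sign.+ (trans (sym (positive (CircleIn-map (E⊆Γ B _ _) C) v∈C)) neg))
      connected v∈B

  blocks-balanced⇒positive-through : ((B : Subgraph Γ) → IsBlock B → V B v → Balanced σ B) →
                                     (C : Circle Γ) → v ∈ verts C → Positive σ C
  blocks-balanced⇒positive-through balanced C v∈C =
    decidable-stable (circleSign σ C ≟ˢ Sign.+) λ not-positive →
    ¬¬-block-above (induced {Γ = Γ} (_∈ verts C)) (circle-ConnNoCut {Γ = Γ} C) λ (B , isBlock , C⊑B) →
    not-positive (balanced B isBlock (proj₁ C⊑B v v∈C)
                           (CircleIn-map (proj₂ C⊑B _ _) (circle-in-induced {Γ = Γ} C)))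

mainTheorem2 : ∀ {n : ℕ} (Γ : Graph n) (σ : Signature Γ) (v : Fin n) →
    ((C : Circle Γ) → v ∈ verts C → Positive σ C)
    ⇔ ((B : Subgraph Γ) → IsBlock B → V B v → Balanced σ B)
mainTheorem2 Γ σ v = mk⇔ (positive-through⇒blocks-balanced σ v) (blocks-balanced⇒positive-through σ v)
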